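{- Let $s,n\ge 1$ and $d\ge 2$, and let $\alpha_1,\ldots,\alpha_d\in\mathcal C(s,n)$. Regard each $\alpha_i$ as its Young diagram $Y(\alpha_i)$, viewed as a set of cells inside a fixed $s\times(n-1)$ rectangle (all diagrams sharing the same upper-left cell). Then $$\mathrm{EMC}(\alpha_1,\ldots,\alpha_d)=\blacktriangle\big(Y(\alpha_1),\ldots,Y(\alpha_d)\big).$$
   Context: $\mathcal C(s,n)$ is the set of weak compositions of $s$ into $n$ parts, i.e. $n$-tuples $(a_0,\ldots,a_{n-1})$ of nonnegative integers with sum $s$. Earth mover's coefficient: for $\alpha_1,\ldots,\alpha_d\in\mathcal C(s,n)$, write $\alpha_i(j)$ for the entry of $\alpha_i$ in position $j\in\{1,\ldots,n\}$. Let $C$ be the array on $[n]^d=\{1,\ldots,n\}^d$ with $C(\mathbf x)$ equal to the taxicab ($\ell^1$) distance from $\mathbf x$ to the main diagonal $\{(t,\ldots,t): t\in\mathbb R\}$. Then $\mathrm{EMC}(\alpha_1,\ldots,\alpha_d)$ is the minimum of $\sum_{\mathbf x\in[n]^d}C(\mathbf x)J(\mathbf x)$ over all arrays $J:[n]^d\to\mathbb Z_{\ge0}$ satisfying $\sum_{\mathbf x:\,x_i=j}J(\mathbf x)=\alpha_i(j)$ for all $1\le i\le d$, $1\le j\le n$. Young diagram of a composition: for $\alpha=(a_0,\ldots,a_{n-1})$, its word $w(\alpha)$ is the weakly increasing sequence consisting of $a_0$ copies of $0$, then $a_1$ copies of $1$, ..., then $a_{n-1}$ copies of $n-1$ (length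 $s$). The Young diagram $Y(\alpha)$ is the left-justified diagram with $s$ rows (some possibly empty) whose row lengths, read from bottom to top, are the entries of $w(\alpha)$; so its row lengths weakly decrease from top to bottom and it fits in an $s\times(n-1)$ rectangle. Unimodal symmetric difference: for finite sets $A_1,\ldots,A_d$, $\blacktriangle(A_1,\ldots,A_d)=\sum_{k=1}^{d-1}\min\{k,d-k\}\cdot\big|\{\text{elements contained in exactly }k\text{ of the }A_i\}\big|$. -}

module Defs where

open import Data.Nat using (ℕ; zero; suc; _+_; _∸_; _*_; _⊓_; _<ᵇ_; ∣_-_∣; _≤_)
open import Data.Fin using (Fin; toℕ; _≟_)
import Data.Fin as F
import Data.Vec
open import Data.Vec using (Vec; []; _∷_; lookup)
open import Data.List using (List; []; _∷_; _++_; replicate)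
open import Data.Bool using (Bool; true; false; if_then_else_)
open import Data.Product using (Σ; _×_; _,_)
open import Relation.Nullary.Decidable using (⌊_⌋)
open import Relation.Binary.PropositionalEquality using (_≡_)

sumFin : (n : ℕ) → (Fin n → ℕ) → ℕ
sumFin zero    f = 0
sumFin (suc n) f = f F.zero + sumFin n (λ j → f (F.suc j))

-- minimum of f over Fin n (returns 0 for n = 0; only used with n ≥ 1)
minFin : (n : ℕ) → (Fin n → ℕ) → ℕ
minFin zero          f = 0
minFin (suc zero)    f = f F.zero
minFin (suc (suc n)) f = f F.zero ⊓ minFin (suc n) (λ j → f (F.suc j))

sumPts : (n d : ℕ) → (Vec (Fin n) d → ℕ) → ℕ
sumPts n zero    f = f []
sumPts n (suc d) f = sumFin n (λ j → sumPts n d (λ x → f (j ∷ x)))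

-- taxicab distance of x ∈ [n]^d to the main diagonal:
-- min over t of Σ_i |x_i - t|, the minimum being taken over t ∈ [n]
-- (positions encoded as 0..n-1; a shift does not change distances)
diagDist : {n d : ℕ} → Vec (Fin n) d → ℕ
diagDist {n} {d} x =
  minFin n (λ t → sumFin d (λ i → ∣ toℕ (lookup x i) - toℕ t ∣))

eqb : {n : ℕ} → Fin n → Fin n → Bool
eqb a b = ⌊ a ≟ b ⌋

Feasible : {n d : ℕ} → (Fin d → Vec ℕ n) → (Vec (Fin n) d → ℕ) → Set
Feasible {n} {d} α J =
  (i : Fin d) (j : Fin n) →
  sumPts n d (λ x → if eqb (lookup x i) j then J x else 0) ≡ lookup (α i) j

cost : {n d : ℕ} → (Vec (Fin n) d → ℕ) → ℕ
cost {n} {d} J = sumPts n d (λ x → diagDist x * J x)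

IsEMC : {n d : ℕ} → (Fin d → Vec ℕ n) → ℕ → Set
IsEMC α v =
  Σ (Vec _ _ → ℕ) (λ J → Feasible α J × cost J ≡ v)
  × (∀ J → Feasible α J → v ≤ cost J)

IsComposition : (s n : ℕ) → Vec ℕ n → Set
IsComposition s n α = Data.Vec.sum α ≡ s

wordFrom : {n : ℕ} → ℕ → Vec ℕ n → List ℕ
wordFrom k []       = []
wordFrom k (a ∷ as) = replicate a k ++ wordFrom (suc k) as

word : {n : ℕ} → Vec ℕ n → List ℕ
word = wordFrom 0

-- r-th entry of a list (0 if out of range)
entry : List ℕ → ℕ → ℕ
entry []       r       = 0
entry (w ∷ ws) zero    = w
entry (w ∷ ws) (suc r) = entry ws r

-- Young diagram Y(α) as a subset of the s × (n-1) rectangle of cells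
-- (row r ∈ Fin s counted from the bottom, column c ∈ Fin (n-1) from the left):
-- cell (r , c) ∈ Y(α)  iff  c < (r-th entry of w(α))
Young : (s n : ℕ) → Vec ℕ n → Fin s × Fin (n ∸ 1) → Bool
Young s n α (r , c) = toℕ c <ᵇ entry (word α) (toℕ r)

count : (d : ℕ) → (Fin d → Bool) → ℕ
count d b = sumFin d (λ i → if b i then 1 else 0)

-- Σ_{k=1}^{d-1} min{k,d-k} · #{elements in exactly k of the A_i}
-- (summed elementwise; elements in 0 or d sets get weight min{k,d-k} = 0,
--  and elements outside the universe lie in no A_i)
triangle : (s m d : ℕ) → (Fin d → Fin s × Fin m → Bool) → ℕ
triangle s m d A =
  sumFin s (λ r → sumFin m (λ c →
    let k = count d (λ i → A i (r , c)) in k ⊓ (d ∸ k)))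

module Submission where

-- Slice at the column thresholds c < n - 1. If k_c(x) coordinates of x ∈ [n]^d exceed c, then the
-- taxicab distance from x to the diagonal is Σ_c min(k_c, d - k_c), attained at a median of x.
-- Sending each row r of the diagrams to the point whose i-th coordinate is the length of row r of
-- Y(α_i) is a feasible plan, and by this formula its cost is ▲(Y(α_1), …, Y(α_d)) column by column.
-- Conversely, fix a feasible J and a column c, and let M be the J-mass of the points with at most
-- half of their coordinates above c. Column c of Y(α_i) is the set of rows r ≥ P_i, where P_i is the
-- J-mass of the points with x_i ≤ c; so column c contributes at most Σ_i |P_i - M| to ▲, and by the
-- triangle inequality this is at most Σ_x J(x) min(k_c(x), d - k_c(x)).

open import Algebra.Properties.CommutativeSemigroup using (interchange)
open import Data.Bool using (Bool; true; false; if_then_else_; not; _xor_; T)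
open import Data.Bool.Properties using (T-≡)
open import Data.Fin using (Fin; toℕ; _≟_)
import Data.Fin as F
open import Data.Fin.Properties using (toℕ<n; toℕ≤pred[n]; toℕ-fromℕ<)
open import Data.List using ([]; _∷_; _++_; replicate; length; map)
open import Data.List.Properties using (length-++; length-replicate)
open import Data.Nat using (ℕ; zero; suc; _+_; _∸_; _*_; _⊓_; _<ᵇ_; _≤ᵇ_; ∣_-_∣; _≤_; _<_; z≤n; s≤s; _≤?_)
open import Data.Nat.ListAction using (sum)
open import Data.Nat.Properties hiding (_≟_)
open import Data.Product using (Σ; _×_; _,_)
open import Data.Vec using (Vec; []; _∷_; lookup; tabulate)
import Data.Vec
open import Data.Vec.Properties using (lookup∘tabulate)
open import Function.Bundles using (Equivalence)
open import Relation.Binary.PropositionalEquality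
open import Relation.Nullary using (yes; no)

open import Defs

𝟙 : Bool → ℕ
𝟙 b = if b then 1 else 0

if-then-0≡𝟙* : ∀ b v → (if b then v else 0) ≡ 𝟙 b * v
if-then-0≡𝟙* true  v = sym (+-identityʳ v)
if-then-0≡𝟙* false v = refl

∣𝟙-𝟙∣≡𝟙-xor : ∀ b e → ∣ 𝟙 b - 𝟙 e ∣ ≡ 𝟙 (e xor b)
∣𝟙-𝟙∣≡𝟙-xor false false = refl
∣𝟙-𝟙∣≡𝟙-xor false true  = refl
∣𝟙-𝟙∣≡𝟙-xor true  false = refl
∣𝟙-𝟙∣≡𝟙-xor true  true  = refl

∣𝟙-𝟙∣≡∣𝟙-not-𝟙-not∣ : ∀ b e → ∣ 𝟙 b - 𝟙 e ∣ ≡ ∣ 𝟙 (not b) - 𝟙 (not e) ∣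
∣𝟙-𝟙∣≡∣𝟙-not-𝟙-not∣ false false = refl
∣𝟙-𝟙∣≡∣𝟙-not-𝟙-not∣ false true  = refl
∣𝟙-𝟙∣≡∣𝟙-not-𝟙-not∣ true  false = refl
∣𝟙-𝟙∣≡∣𝟙-not-𝟙-not∣ true  true  = refl

<⇒<ᵇ≡true : ∀ {m n} → m < n → (m <ᵇ n) ≡ true
<⇒<ᵇ≡true m<n = Equivalence.to T-≡ (<⇒<ᵇ m<n)

<ᵇ≡true⇒< : ∀ {m n} → (m <ᵇ n) ≡ true → m < n
<ᵇ≡true⇒< {m} {n} eq = <ᵇ⇒< m n (Equivalence.from T-≡ eq)

<ᵇ≡false⇒≥ : ∀ {m n} → (m <ᵇ n) ≡ false → n ≤ m
<ᵇ≡false⇒≥ eq = ≮⇒≥ (λ m<n → subst T eq (<⇒<ᵇ m<n))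

<ᵇ-suc : ∀ m n → (m <ᵇ suc n) ≡ (m ≤ᵇ n)
<ᵇ-suc zero    n = refl
<ᵇ-suc (suc m) n = refl

≤ᵇ≡not-<ᵇ : ∀ m n → (m ≤ᵇ n) ≡ not (n <ᵇ m)
≤ᵇ≡not-<ᵇ zero    n       = refl
≤ᵇ≡not-<ᵇ (suc m) zero    = refl
≤ᵇ≡not-<ᵇ (suc m) (suc n) = trans (<ᵇ-suc m n) (≤ᵇ≡not-<ᵇ m n)

𝟙-<ᵇ-antitoneˡ : ∀ {c c'} a → c ≤ c' → 𝟙 (c' <ᵇ a) ≤ 𝟙 (c <ᵇ a)
𝟙-<ᵇ-antitoneˡ {c} {c'} a c≤c' with c' <ᵇ a in eq
... | false = z≤n
... | true  = ≤-reflexive (cong 𝟙 (sym (<⇒<ᵇ≡true (≤-<-trans c≤c' (<ᵇ≡true⇒< {c'} {a} eq)))))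

<ᵇ-⊓ : ∀ c a m → c < m → (c <ᵇ a ⊓ m) ≡ (c <ᵇ a)
<ᵇ-⊓ c       zero    m       _         = refl
<ᵇ-⊓ zero    (suc a) (suc m) _         = refl
<ᵇ-⊓ (suc c) (suc a) (suc m) (s≤s c<m) = <ᵇ-⊓ c a m c<m

∣m+n-o+p∣≤∣m-o∣+∣n-p∣ : ∀ m n o p → ∣ m + n - (o + p) ∣ ≤ ∣ m - o ∣ + ∣ n - p ∣
∣m+n-o+p∣≤∣m-o∣+∣n-p∣ m n o p = begin
  ∣ m + n - (o + p) ∣                       ≤⟨ ∣-∣-triangle (m + n) (o + n) (o + p) ⟩
  ∣ m + n - (o + n) ∣ + ∣ o + n - (o + p) ∣ ≡⟨ cong₂ _+_ ∣m+n-o+n∣≡∣m-o∣ (∣m+n-m+o∣≡∣n-o∣ o n p) ⟩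
  ∣ m - o ∣ + ∣ n - p ∣                     ∎
  where
  open ≤-Reasoning
  ∣m+n-o+n∣≡∣m-o∣ : ∣ m + n - (o + n) ∣ ≡ ∣ m - o ∣
  ∣m+n-o+n∣≡∣m-o∣ = trans (cong₂ ∣_-_∣ (+-comm m n) (+-comm o n)) (∣m+n-m+o∣≡∣n-o∣ n m o)

∣m⊓o-n⊓o∣≤∣m-n∣ : ∀ m n o → ∣ m ⊓ o - n ⊓ o ∣ ≤ ∣ m - n ∣
∣m⊓o-n⊓o∣≤∣m-n∣ m       n       zero    = ≤-trans (≤-reflexive (cong₂ ∣_-_∣ (⊓-zeroʳ m) (⊓-zeroʳ n))) z≤n
∣m⊓o-n⊓o∣≤∣m-n∣ zero    zero    (suc o) = z≤n
∣m⊓o-n⊓o∣≤∣m-n∣ zero    (suc n) (suc o) = s≤s (m⊓n≤m n o)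
∣m⊓o-n⊓o∣≤∣m-n∣ (suc m) zero    (suc o) = s≤s (m⊓n≤m m o)
∣m⊓o-n⊓o∣≤∣m-n∣ (suc m) (suc n) (suc o) = ∣m⊓o-n⊓o∣≤∣m-n∣ m n o

sumFin-cong : ∀ n {f g : Fin n → ℕ} → (∀ j → f j ≡ g j) → sumFin n f ≡ sumFin n g
sumFin-cong zero    f≗g = refl
sumFin-cong (suc n) f≗g = cong₂ _+_ (f≗g F.zero) (sumFin-cong n (λ j → f≗g (F.suc j)))

sumFin-mono-≤ : ∀ n {f g : Fin n → ℕ} → (∀ j → f j ≤ g j) → sumFin n f ≤ sumFin n g
sumFin-mono-≤ zero    f≤g = z≤n
sumFin-mono-≤ (suc n) f≤g = +-mono-≤ (f≤g F.zero) (sumFin-mono-≤ n (λ j → f≤g (F.suc j)))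

sumFin-zero : ∀ n {f : Fin n → ℕ} → (∀ j → f j ≡ 0) → sumFin n f ≡ 0
sumFin-zero zero    f≗0 = refl
sumFin-zero (suc n) f≗0 = cong₂ _+_ (f≗0 F.zero) (sumFin-zero n (λ j → f≗0 (F.suc j)))

sumFin-distrib-+ : ∀ n (f g : Fin n → ℕ) → sumFin n (λ j → f j + g j) ≡ sumFin n f + sumFin n g
sumFin-distrib-+ zero    f g = refl
sumFin-distrib-+ (suc n) f g =
  trans (cong (f F.zero + g F.zero +_) (sumFin-distrib-+ n (λ j → f (F.suc j)) (λ j → g (F.suc j))))
        (interchange +-commutativeSemigroup (f F.zero) (g F.zero) _ _)

sumFin-distribʳ-* : ∀ n (f : Fin n → ℕ) c → sumFin n (λ j → f j * c) ≡ sumFin n f * c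
sumFin-distribʳ-* zero    f c = refl
sumFin-distribʳ-* (suc n) f c =
  trans (cong (f F.zero * c +_) (sumFin-distribʳ-* n (λ j → f (F.suc j)) c))
        (sym (*-distribʳ-+ c (f F.zero) _))

sumFin-distribˡ-* : ∀ n (f : Fin n → ℕ) c → sumFin n (λ j → c * f j) ≡ c * sumFin n f
sumFin-distribˡ-* n f c =
  trans (sumFin-cong n (λ j → *-comm c (f j))) (trans (sumFin-distribʳ-* n f c) (*-comm _ c))

sumFin-comm : ∀ n m (f : Fin n → Fin m → ℕ) →
  sumFin n (λ a → sumFin m (λ b → f a b)) ≡ sumFin m (λ b → sumFin n (λ a → f a b))
sumFin-comm zero    m f = sym (sumFin-zero m (λ _ → refl))
sumFin-comm (suc n) m f =
  trans (cong (sumFin m (f F.zero) +_) (sumFin-comm n m (λ a → f (F.suc a))))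
        (sym (sumFin-distrib-+ m (f F.zero) (λ b → sumFin n (λ a → f (F.suc a) b))))

∣sumFin-sumFin∣≤sumFin∣-∣ : ∀ n (f g : Fin n → ℕ) →
  ∣ sumFin n f - sumFin n g ∣ ≤ sumFin n (λ j → ∣ f j - g j ∣)
∣sumFin-sumFin∣≤sumFin∣-∣ zero    f g = z≤n
∣sumFin-sumFin∣≤sumFin∣-∣ (suc n) f g =
  ≤-trans (∣m+n-o+p∣≤∣m-o∣+∣n-p∣ (f F.zero) _ (g F.zero) _)
          (+-monoʳ-≤ ∣ f F.zero - g F.zero ∣ (∣sumFin-sumFin∣≤sumFin∣-∣ n (λ j → f (F.suc j)) (λ j → g (F.suc j))))

eqb-suc : ∀ {n} (a b : Fin n) → eqb (F.suc a) (F.suc b) ≡ eqb a b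
eqb-suc a b with a ≟ b
... | yes _ = refl
... | no  _ = refl

eqb-sym : ∀ {n} (a b : Fin n) → eqb a b ≡ eqb b a
eqb-sym F.zero    F.zero    = refl
eqb-sym F.zero    (F.suc b) = refl
eqb-sym (F.suc a) F.zero    = refl
eqb-sym (F.suc a) (F.suc b) = trans (eqb-suc a b) (trans (eqb-sym a b) (sym (eqb-suc b a)))

sumFin-𝟙-eqb : ∀ n (a : Fin n) (h : Fin n → ℕ) → sumFin n (λ j → 𝟙 (eqb a j) * h j) ≡ h a
sumFin-𝟙-eqb (suc n) F.zero h =
  trans (cong₂ _+_ (+-identityʳ (h F.zero)) (sumFin-zero n (λ _ → refl))) (+-identityʳ _)
sumFin-𝟙-eqb (suc n) (F.suc a) h =
  trans (sumFin-cong n (λ j → cong (λ b → 𝟙 b * h (F.suc j)) (eqb-suc a j)))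
        (sumFin-𝟙-eqb n a (λ j → h (F.suc j)))

count+count-not≡ : ∀ d (b : Fin d → Bool) → count d b + count d (λ i → not (b i)) ≡ d
count+count-not≡ zero    b = refl
count+count-not≡ (suc d) b with b F.zero
... | true  = cong suc (count+count-not≡ d (λ i → b (F.suc i)))
... | false = trans (+-suc (count d (λ i → b (F.suc i))) _) (cong suc (count+count-not≡ d (λ i → b (F.suc i))))

count≤ : ∀ d (b : Fin d → Bool) → count d b ≤ d
count≤ d b = subst (count d b ≤_) (count+count-not≡ d b) (m≤m+n _ _)

sumFin-∣𝟙-𝟙∣≡count : ∀ d (b : Fin d → Bool) e →
  sumFin d (λ i → ∣ 𝟙 (b i) - 𝟙 e ∣) ≡ (if e then d ∸ count d b else count d b)
sumFin-∣𝟙-𝟙∣≡count d b false = sumFin-cong d (λ i → ∣𝟙-𝟙∣≡𝟙-xor (b i) false)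
sumFin-∣𝟙-𝟙∣≡count d b true  = begin
  sumFin d (λ i → ∣ 𝟙 (b i) - 1 ∣)                           ≡⟨ sumFin-cong d (λ i → ∣𝟙-𝟙∣≡𝟙-xor (b i) true) ⟩
  count d (λ i → not (b i))                                   ≡⟨ m+n∸m≡n (count d b) _ ⟨
  count d b + count d (λ i → not (b i)) ∸ count d b           ≡⟨ cong (_∸ count d b) (count+count-not≡ d b) ⟩
  d ∸ count d b                                               ∎
  where open ≡-Reasoning

minority : ℕ → ℕ → ℕ
minority d k = k ⊓ (d ∸ k)

minority≤ : ∀ d k e → minority d k ≤ (if e then d ∸ k else k)
minority≤ d k true  = m⊓n≤n k _
minority≤ d k false = m⊓n≤m k _

minority≡ : ∀ d k → k ≤ d → minority d k ≡ (if d <ᵇ k + k then d ∸ k else k)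
minority≡ d k k≤d with d <ᵇ k + k in eq
... | true  = m≥n⇒m⊓n≡n (≤-trans (∸-monoˡ-≤ k (<⇒≤ (<ᵇ≡true⇒< eq))) (≤-reflexive (m+n∸n≡m k k)))
... | false = m≤n⇒m⊓n≡m (≤-trans (≤-reflexive (sym (m+n∸n≡m k k))) (∸-monoˡ-≤ k (<ᵇ≡false⇒≥ eq)))

layerCake : ∀ N a b → sumFin N (λ c → ∣ 𝟙 (toℕ c <ᵇ a) - 𝟙 (toℕ c <ᵇ b) ∣) ≡ ∣ a ⊓ N - b ⊓ N ∣
layerCake zero    zero    zero    = refl
layerCake zero    zero    (suc b) = refl
layerCake zero    (suc a) zero    = refl
layerCake zero    (suc a) (suc b) = refl
layerCake (suc N) zero    zero    = layerCake N zero zero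
layerCake (suc N) zero    (suc b) = cong suc (layerCake N zero b)
layerCake (suc N) (suc a) zero    = cong suc (trans (layerCake N a zero) (∣-∣-identityʳ (a ⊓ N)))
layerCake (suc N) (suc a) (suc b) = layerCake N a b

Monotone Antitone : (ℕ → ℕ) → Set
Monotone A = ∀ {c c'} → c ≤ c' → A c ≤ A c'
Antitone B = ∀ {c c'} → c ≤ c' → B c' ≤ B c

-- Take t to be the first level at which A exceeds B.
switchpoint : ∀ N (A B : ℕ → ℕ) → Monotone A → Antitone B →
  Σ ℕ λ t → t ≤ N × sumFin N (λ c → if toℕ c <ᵇ t then A (toℕ c) else B (toℕ c)) ≤ sumFin N (λ c → A (toℕ c) ⊓ B (toℕ c))
switchpoint zero    A B A↑ B↓ = 0 , z≤n , z≤n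
switchpoint (suc N) A B A↑ B↓ with A 0 ≤? B 0
... | yes A0≤B0 with switchpoint N (λ c → A (suc c)) (λ c → B (suc c)) (λ c≤c' → A↑ (s≤s c≤c')) (λ c≤c' → B↓ (s≤s c≤c'))
...   | t , t≤N , sum≤ = suc t , s≤s t≤N , +-mono-≤ (≤-reflexive (sym (m≤n⇒m⊓n≡m A0≤B0))) sum≤
switchpoint (suc N) A B A↑ B↓ | no A0≰B0 = 0 , z≤n , sumFin-mono-≤ (suc N) (λ c →
  ≤-reflexive (sym (m≥n⇒m⊓n≡n (≤-trans (B↓ {0} {toℕ c} z≤n) (≤-trans (<⇒≤ (≰⇒> A0≰B0)) (A↑ {0} {toℕ c} z≤n))))))

minFin-glb : ∀ n (f : Fin (suc n) → ℕ) {b} → (∀ t → b ≤ f t) → b ≤ minFin (suc n) f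
minFin-glb zero    f b≤f = b≤f F.zero
minFin-glb (suc n) f b≤f = ⊓-glb (b≤f F.zero) (minFin-glb n (λ j → f (F.suc j)) (λ j → b≤f (F.suc j)))

minFin≤ : ∀ n (f : Fin (suc n) → ℕ) t → minFin (suc n) f ≤ f t
minFin≤ zero    f F.zero    = ≤-refl
minFin≤ (suc n) f F.zero    = m⊓n≤m _ _
minFin≤ (suc n) f (F.suc t) = ≤-trans (m⊓n≤n _ _) (minFin≤ n (λ j → f (F.suc j)) t)

above : ∀ {n d} → Vec (Fin n) d → ℕ → ℕ
above {d = d} x c = count d (λ i → c <ᵇ toℕ (lookup x i))

above-antitone : ∀ {n d} (x : Vec (Fin n) d) → Antitone (above x)
above-antitone {d = d} x {c} {c'} c≤c' = sumFin-mono-≤ d (λ i → 𝟙-<ᵇ-antitoneˡ {c} {c'} (toℕ (lookup x i)) c≤c')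

sumFin-∣x-t∣≡layers : ∀ {m d} (x : Vec (Fin (suc m)) d) (t : Fin (suc m)) →
  sumFin d (λ i → ∣ toℕ (lookup x i) - toℕ t ∣) ≡
  sumFin m (λ c → if toℕ c <ᵇ toℕ t then d ∸ above x (toℕ c) else above x (toℕ c))
sumFin-∣x-t∣≡layers {m} {d} x t = begin
  sumFin d (λ i → ∣ toℕ (lookup x i) - toℕ t ∣)
    ≡⟨ sumFin-cong d (λ i → trans (cong₂ ∣_-_∣ (sym (⊓≤ (lookup x i))) (sym (⊓≤ t))) (sym (layerCake m (toℕ (lookup x i)) (toℕ t)))) ⟩
  sumFin d (λ i → sumFin m (λ c → ∣ 𝟙 (toℕ c <ᵇ toℕ (lookup x i)) - 𝟙 (toℕ c <ᵇ toℕ t) ∣))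
    ≡⟨ sumFin-comm d m _ ⟩
  sumFin m (λ c → sumFin d (λ i → ∣ 𝟙 (toℕ c <ᵇ toℕ (lookup x i)) - 𝟙 (toℕ c <ᵇ toℕ t) ∣))
    ≡⟨ sumFin-cong m (λ c → sumFin-∣𝟙-𝟙∣≡count d _ (toℕ c <ᵇ toℕ t)) ⟩
  sumFin m (λ c → if toℕ c <ᵇ toℕ t then d ∸ above x (toℕ c) else above x (toℕ c)) ∎
  where
  open ≡-Reasoning
  ⊓≤ : (a : Fin (suc m)) → toℕ a ⊓ m ≡ toℕ a
  ⊓≤ a = m≤n⇒m⊓n≡m (toℕ≤pred[n] a)

-- The optimal diagonal point is a median of the coordinates.
diagDist≡sumFin-minority : ∀ {m d} (x : Vec (Fin (suc m)) d) →
  diagDist x ≡ sumFin m (λ c → minority d (above x (toℕ c)))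
diagDist≡sumFin-minority {m} {d} x = ≤-antisym upper lower
  where
  lower : sumFin m (λ c → minority d (above x (toℕ c))) ≤ diagDist x
  lower = minFin-glb m _ (λ t → ≤-trans
    (sumFin-mono-≤ m (λ c → minority≤ d (above x (toℕ c)) (toℕ c <ᵇ toℕ t)))
    (≤-reflexive (sym (sumFin-∣x-t∣≡layers x t))))
  upper : diagDist x ≤ sumFin m (λ c → minority d (above x (toℕ c)))
  upper with switchpoint m (λ c → d ∸ above x c) (above x) (λ c≤c' → ∸-monoʳ-≤ d (above-antitone x c≤c')) (above-antitone x)
  ... | t , t≤m , switch≤ = begin
    diagDist x                    ≤⟨ minFin≤ m _ median ⟩
    sumFin d (λ i → ∣ toℕ (lookup x i) - toℕ median ∣)
      ≡⟨ sumFin-∣x-t∣≡layers x median ⟩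
    sumFin m (λ c → if toℕ c <ᵇ toℕ median then d ∸ above x (toℕ c) else above x (toℕ c))
      ≡⟨ cong (λ t' → sumFin m (λ c → if toℕ c <ᵇ t' then d ∸ above x (toℕ c) else above x (toℕ c))) (toℕ-fromℕ< (s≤s t≤m)) ⟩
    sumFin m (λ c → if toℕ c <ᵇ t then d ∸ above x (toℕ c) else above x (toℕ c))
      ≤⟨ switch≤ ⟩
    sumFin m (λ c → (d ∸ above x (toℕ c)) ⊓ above x (toℕ c))
      ≡⟨ sumFin-cong m (λ c → ⊓-comm _ _) ⟩
    sumFin m (λ c → minority d (above x (toℕ c))) ∎
    where
    open ≤-Reasoning
    median : Fin (suc m)
    median = F.fromℕ< (s≤s t≤m)

sumPts-cong : ∀ n d {f g : Vec (Fin n) d → ℕ} → (∀ x → f x ≡ g x) → sumPts n d f ≡ sumPts n d g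
sumPts-cong n zero    f≗g = f≗g []
sumPts-cong n (suc d) f≗g = sumFin-cong n (λ j → sumPts-cong n d (λ x → f≗g (j ∷ x)))

sumPts-mono-≤ : ∀ n d {f g : Vec (Fin n) d → ℕ} → (∀ x → f x ≤ g x) → sumPts n d f ≤ sumPts n d g
sumPts-mono-≤ n zero    f≤g = f≤g []
sumPts-mono-≤ n (suc d) f≤g = sumFin-mono-≤ n (λ j → sumPts-mono-≤ n d (λ x → f≤g (j ∷ x)))

sumPts-distribʳ-* : ∀ n d (f : Vec (Fin n) d → ℕ) c → sumPts n d (λ x → f x * c) ≡ sumPts n d f * c
sumPts-distribʳ-* n zero    f c = refl
sumPts-distribʳ-* n (suc d) f c =
  trans (sumFin-cong n (λ j → sumPts-distribʳ-* n d (λ x → f (j ∷ x)) c)) (sumFin-distribʳ-* n _ c)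

sumPts-distribˡ-* : ∀ n d (f : Vec (Fin n) d → ℕ) c → sumPts n d (λ x → c * f x) ≡ c * sumPts n d f
sumPts-distribˡ-* n d f c =
  trans (sumPts-cong n d (λ x → *-comm c (f x))) (trans (sumPts-distribʳ-* n d f c) (*-comm _ c))

sumPts-sumFin-comm : ∀ n d m (f : Vec (Fin n) d → Fin m → ℕ) →
  sumPts n d (λ x → sumFin m (f x)) ≡ sumFin m (λ b → sumPts n d (λ x → f x b))
sumPts-sumFin-comm n zero    m f = refl
sumPts-sumFin-comm n (suc d) m f =
  trans (sumFin-cong n (λ j → sumPts-sumFin-comm n d m (λ x → f (j ∷ x))))
        (sumFin-comm n m (λ j b → sumPts n d (λ x → f (j ∷ x) b)))

∣sumPts-sumPts∣≤sumPts∣-∣ : ∀ n d (f g : Vec (Fin n) d → ℕ) →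
  ∣ sumPts n d f - sumPts n d g ∣ ≤ sumPts n d (λ x → ∣ f x - g x ∣)
∣sumPts-sumPts∣≤sumPts∣-∣ n zero    f g = ≤-refl
∣sumPts-sumPts∣≤sumPts∣-∣ n (suc d) f g =
  ≤-trans (∣sumFin-sumFin∣≤sumFin∣-∣ n _ _)
          (sumFin-mono-≤ n (λ j → ∣sumPts-sumPts∣≤sumPts∣-∣ n d (λ x → f (j ∷ x)) (λ x → g (j ∷ x))))

δ : ∀ {n d} → Vec (Fin n) d → Vec (Fin n) d → ℕ
δ []       []       = 1
δ (y ∷ ys) (x ∷ xs) = 𝟙 (eqb y x) * δ ys xs

sumPts-δ : ∀ n d (y : Vec (Fin n) d) (g : Vec (Fin n) d → ℕ) → sumPts n d (λ x → δ y x * g x) ≡ g y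
sumPts-δ n zero    []       g = +-identityʳ (g [])
sumPts-δ n (suc d) (y ∷ ys) g = trans (sumFin-cong n inner) (sumFin-𝟙-eqb n y (λ j → g (j ∷ ys)))
  where
  inner : ∀ j → sumPts n d (λ x → 𝟙 (eqb y j) * δ ys x * g (j ∷ x)) ≡ 𝟙 (eqb y j) * g (j ∷ ys)
  inner j = begin
    sumPts n d (λ x → 𝟙 (eqb y j) * δ ys x * g (j ∷ x))   ≡⟨ sumPts-cong n d (λ x → *-assoc (𝟙 (eqb y j)) (δ ys x) _) ⟩
    sumPts n d (λ x → 𝟙 (eqb y j) * (δ ys x * g (j ∷ x))) ≡⟨ sumPts-distribˡ-* n d _ (𝟙 (eqb y j)) ⟩
    𝟙 (eqb y j) * sumPts n d (λ x → δ ys x * g (j ∷ x))   ≡⟨ cong (𝟙 (eqb y j) *_) (sumPts-δ n d ys (λ x → g (j ∷ x))) ⟩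
    𝟙 (eqb y j) * g (j ∷ ys)                              ∎
    where open ≡-Reasoning

sumFin-entry≡sum-map : ∀ (g : ℕ → ℕ) w → sumFin (length w) (λ r → g (entry w (toℕ r))) ≡ sum (map g w)
sumFin-entry≡sum-map g []      = refl
sumFin-entry≡sum-map g (a ∷ w) = cong (g a +_) (sumFin-entry≡sum-map g w)

sum-map-replicate-++ : ∀ (g : ℕ → ℕ) a k w → sum (map g (replicate a k ++ w)) ≡ a * g k + sum (map g w)
sum-map-replicate-++ g zero    k w = refl
sum-map-replicate-++ g (suc a) k w = trans (cong (g k +_) (sum-map-replicate-++ g a k w)) (sym (+-assoc (g k) _ _))

sum-map-wordFrom : ∀ (g : ℕ → ℕ) {n} k (α : Vec ℕ n) →
  sum (map g (wordFrom k α)) ≡ sumFin n (λ j → lookup α j * g (k + toℕ j))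
sum-map-wordFrom g         k []       = refl
sum-map-wordFrom g {suc n} k (a ∷ as) =
  trans (sum-map-replicate-++ g a k (wordFrom (suc k) as))
        (cong₂ _+_ (cong (λ k' → a * g k') (sym (+-identityʳ k)))
                   (trans (sum-map-wordFrom g (suc k) as)
                          (sumFin-cong n (λ j → cong (λ k' → lookup as j * g k') (sym (+-suc k (toℕ j)))))))

length-wordFrom : ∀ {n} k (α : Vec ℕ n) → length (wordFrom k α) ≡ Data.Vec.sum α
length-wordFrom k []       = refl
length-wordFrom k (a ∷ as) =
  trans (length-++ (replicate a k)) (cong₂ _+_ (length-replicate a) (length-wordFrom (suc k) as))

sumFin-rows : ∀ (g : ℕ → ℕ) {n s} (α : Vec ℕ n) → Data.Vec.sum α ≡ s →
  sumFin s (λ r → g (entry (word α) (toℕ r))) ≡ sumFin n (λ j → lookup α j * g (toℕ j))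
sumFin-rows g α refl = begin
  sumFin (Data.Vec.sum α) (λ r → g (entry (word α) (toℕ r)))
    ≡⟨ cong (λ s → sumFin s (λ r → g (entry (word α) (toℕ r)))) (sym (length-wordFrom 0 α)) ⟩
  sumFin (length (word α)) (λ r → g (entry (word α) (toℕ r)))
    ≡⟨ sumFin-entry≡sum-map g (word α) ⟩
  sum (map g (word α))
    ≡⟨ sum-map-wordFrom g 0 α ⟩
  sumFin _ (λ j → lookup α j * g (toℕ j)) ∎
  where open ≡-Reasoning

-- The number of letters ≤ c in wordFrom k α; for k = 0, the number of rows of Y(α) of length ≤ c.
atMost : ∀ {n} → ℕ → ℕ → Vec ℕ n → ℕ
atMost {n} c k α = sumFin n (λ j → lookup α j * 𝟙 (not (c <ᵇ k + toℕ j)))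

atMost-∷ : ∀ {n} c k a (as : Vec ℕ n) → atMost c k (a ∷ as) ≡ a * 𝟙 (not (c <ᵇ k)) + atMost c (suc k) as
atMost-∷ {n} c k a as =
  cong₂ _+_ (cong (λ k' → a * 𝟙 (not (c <ᵇ k'))) (+-identityʳ k))
            (sumFin-cong n (λ j → cong (λ k' → lookup as j * 𝟙 (not (c <ᵇ k'))) (+-suc k (toℕ j))))

atMost-< : ∀ {n} c k (α : Vec ℕ n) → c < k → atMost c k α ≡ 0
atMost-< {n} c k α c<k = sumFin-zero n (λ j →
  trans (cong (λ b → lookup α j * 𝟙 (not b)) (<⇒<ᵇ≡true (≤-trans c<k (m≤m+n k (toℕ j)))))
        (*-zeroʳ (lookup α j)))

entry-replicate-++-≥ : ∀ a k w r → (∀ r → r < length w → k ≤ entry w r) →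
  r < length (replicate a k ++ w) → k ≤ entry (replicate a k ++ w) r
entry-replicate-++-≥ zero    k w r       w≥k r<len       = w≥k r r<len
entry-replicate-++-≥ (suc a) k w zero    w≥k r<len       = ≤-refl
entry-replicate-++-≥ (suc a) k w (suc r) w≥k (s≤s r<len) = entry-replicate-++-≥ a k w r w≥k r<len

entry-wordFrom-≥ : ∀ {n} k (α : Vec ℕ n) r → r < length (wordFrom k α) → k ≤ entry (wordFrom k α) r
entry-wordFrom-≥ k (a ∷ as) r r<len = entry-replicate-++-≥ a k _ r
  (λ r' r'<len → ≤-trans (n≤1+n k) (entry-wordFrom-≥ (suc k) as r' r'<len)) r<len

<ᵇ-entry-replicate-++ : ∀ c a k w P → (c <ᵇ k) ≡ false →
  (∀ r → r < length w → (c <ᵇ entry w r) ≡ (P ≤ᵇ r)) →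
  ∀ r → r < length (replicate a k ++ w) → (c <ᵇ entry (replicate a k ++ w) r) ≡ (a + P ≤ᵇ r)
<ᵇ-entry-replicate-++ c zero    k w P c≮k w-above r       r<len       = w-above r r<len
<ᵇ-entry-replicate-++ c (suc a) k w P c≮k w-above zero    r<len       = c≮k
<ᵇ-entry-replicate-++ c (suc a) k w P c≮k w-above (suc r) (s≤s r<len) =
  trans (<ᵇ-entry-replicate-++ c a k w P c≮k w-above r r<len) (sym (<ᵇ-suc (a + P) r))

-- The word is weakly increasing, so its entries exceed c exactly from position atMost c k α on.
<ᵇ-entry-wordFrom : ∀ {n} c k (α : Vec ℕ n) r → r < length (wordFrom k α) →
  (c <ᵇ entry (wordFrom k α) r) ≡ (atMost c k α ≤ᵇ r)
<ᵇ-entry-wordFrom c k (a ∷ as) r r<len with c <ᵇ k in c<ᵇk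
... | true  = trans (<⇒<ᵇ≡true (≤-trans (<ᵇ≡true⇒< c<ᵇk) (entry-wordFrom-≥ k (a ∷ as) r r<len)))
                    (cong (_≤ᵇ r) (sym (atMost-< c k (a ∷ as) (<ᵇ≡true⇒< c<ᵇk))))
... | false = trans (<ᵇ-entry-replicate-++ c a k _ (atMost c (suc k) as) c<ᵇk (<ᵇ-entry-wordFrom c (suc k) as) r r<len)
                    (cong (_≤ᵇ r) (sym atMost≡))
  where
  atMost≡ : atMost c k (a ∷ as) ≡ a + atMost c (suc k) as
  atMost≡ = begin
    atMost c k (a ∷ as)                          ≡⟨ atMost-∷ c k a as ⟩
    a * 𝟙 (not (c <ᵇ k)) + atMost c (suc k) as   ≡⟨ cong (λ b → a * 𝟙 (not b) + atMost c (suc k) as) c<ᵇk ⟩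
    a * 1 + atMost c (suc k) as                  ≡⟨ cong (_+ atMost c (suc k) as) (*-identityʳ a) ⟩
    a + atMost c (suc k) as                      ∎
    where open ≡-Reasoning

sumFin-∣𝟙≤ᵇ-𝟙≤ᵇ∣≤∣-∣ : ∀ s P M → sumFin s (λ r → ∣ 𝟙 (P ≤ᵇ toℕ r) - 𝟙 (M ≤ᵇ toℕ r) ∣) ≤ ∣ P - M ∣
sumFin-∣𝟙≤ᵇ-𝟙≤ᵇ∣≤∣-∣ s P M = begin
  sumFin s (λ r → ∣ 𝟙 (P ≤ᵇ toℕ r) - 𝟙 (M ≤ᵇ toℕ r) ∣)
    ≡⟨ sumFin-cong s (λ r → trans (cong₂ (λ b e → ∣ 𝟙 b - 𝟙 e ∣) (≤ᵇ≡not-<ᵇ P (toℕ r)) (≤ᵇ≡not-<ᵇ M (toℕ r)))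
                                  (sym (∣𝟙-𝟙∣≡∣𝟙-not-𝟙-not∣ (toℕ r <ᵇ P) (toℕ r <ᵇ M)))) ⟩
  sumFin s (λ r → ∣ 𝟙 (toℕ r <ᵇ P) - 𝟙 (toℕ r <ᵇ M) ∣) ≡⟨ layerCake s P M ⟩
  ∣ P ⊓ s - M ⊓ s ∣                                     ≤⟨ ∣m⊓o-n⊓o∣≤∣m-n∣ P M s ⟩
  ∣ P - M ∣                                             ∎
  where open ≤-Reasoning

feasible-marginal : ∀ {n d} {α : Fin d → Vec ℕ n} {J : Vec (Fin n) d → ℕ} → Feasible α J →
  ∀ i (g : Fin n → ℕ) → sumPts n d (λ x → g (lookup x i) * J x) ≡ sumFin n (λ j → lookup (α i) j * g j)
feasible-marginal {n} {d} {α} {J} feasible i g = begin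
  sumPts n d (λ x → g (lookup x i) * J x)
    ≡⟨ sumPts-cong n d (λ x → sym (sumFin-𝟙-eqb n (lookup x i) (λ j → g j * J x))) ⟩
  sumPts n d (λ x → sumFin n (λ j → 𝟙 (eqb (lookup x i) j) * (g j * J x)))
    ≡⟨ sumPts-cong n d (λ x → sumFin-cong n (λ j → regroup (eqb (lookup x i) j) (g j) (J x))) ⟩
  sumPts n d (λ x → sumFin n (λ j → (if eqb (lookup x i) j then J x else 0) * g j))
    ≡⟨ sumPts-sumFin-comm n d n _ ⟩
  sumFin n (λ j → sumPts n d (λ x → (if eqb (lookup x i) j then J x else 0) * g j))
    ≡⟨ sumFin-cong n (λ j → trans (sumPts-distribʳ-* n d _ (g j)) (cong (_* g j) (feasible i j))) ⟩
  sumFin n (λ j → lookup (α i) j * g j) ∎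
  where
  open ≡-Reasoning
  regroup : ∀ b u v → 𝟙 b * (u * v) ≡ (if b then v else 0) * u
  regroup b u v = sym (trans (cong (_* u) (if-then-0≡𝟙* b v))
                             (trans (*-assoc (𝟙 b) v u) (cong (𝟙 b *_) (*-comm v u))))

-- Row lengths are at most m, so clamping to Fin (suc m) loses nothing.
clamp : ∀ m → ℕ → Fin (suc m)
clamp zero    a       = F.zero
clamp (suc m) zero    = F.zero
clamp (suc m) (suc a) = F.suc (clamp m a)

clamp-toℕ : ∀ m (j : Fin (suc m)) → clamp m (toℕ j) ≡ j
clamp-toℕ zero    F.zero    = refl
clamp-toℕ (suc m) F.zero    = refl
clamp-toℕ (suc m) (F.suc j) = cong F.suc (clamp-toℕ m j)

toℕ-clamp : ∀ m a → toℕ (clamp m a) ≡ a ⊓ m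
toℕ-clamp zero    zero    = refl
toℕ-clamp zero    (suc a) = refl
toℕ-clamp (suc m) zero    = refl
toℕ-clamp (suc m) (suc a) = cong suc (toℕ-clamp m a)

module _ (s m d : ℕ) (α : Fin d → Vec ℕ (suc m)) (α∈C : ∀ i → IsComposition s (suc m) (α i)) where

  rowLength : Fin d → Fin s → ℕ
  rowLength i r = entry (word (α i)) (toℕ r)

  rowPoint : Fin s → Vec (Fin (suc m)) d
  rowPoint r = tabulate (λ i → clamp m (rowLength i r))

  rowPlan : Vec (Fin (suc m)) d → ℕ
  rowPlan x = sumFin s (λ r → δ (rowPoint r) x)

  sumPts-*-rowPlan : (g : Vec (Fin (suc m)) d → ℕ) →
    sumPts (suc m) d (λ x → g x * rowPlan x) ≡ sumFin s (λ r → g (rowPoint r))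
  sumPts-*-rowPlan g = begin
    sumPts (suc m) d (λ x → g x * rowPlan x)
      ≡⟨ sumPts-cong (suc m) d (λ x → trans (sym (sumFin-distribˡ-* s (λ r → δ (rowPoint r) x) (g x)))
                                           (sumFin-cong s (λ r → *-comm (g x) (δ (rowPoint r) x)))) ⟩
    sumPts (suc m) d (λ x → sumFin s (λ r → δ (rowPoint r) x * g x))
      ≡⟨ sumPts-sumFin-comm (suc m) d s _ ⟩
    sumFin s (λ r → sumPts (suc m) d (λ x → δ (rowPoint r) x * g x))
      ≡⟨ sumFin-cong s (λ r → sumPts-δ (suc m) d (rowPoint r) g) ⟩
    sumFin s (λ r → g (rowPoint r)) ∎
    where open ≡-Reasoning

  rowPlan-feasible : Feasible α rowPlan
  rowPlan-feasible i j = begin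
    sumPts (suc m) d (λ x → if eqb (lookup x i) j then rowPlan x else 0)
      ≡⟨ sumPts-cong (suc m) d (λ x → if-then-0≡𝟙* (eqb (lookup x i) j) (rowPlan x)) ⟩
    sumPts (suc m) d (λ x → 𝟙 (eqb (lookup x i) j) * rowPlan x)
      ≡⟨ sumPts-*-rowPlan (λ x → 𝟙 (eqb (lookup x i) j)) ⟩
    sumFin s (λ r → 𝟙 (eqb (lookup (rowPoint r) i) j))
      ≡⟨ sumFin-cong s (λ r → cong (λ a → 𝟙 (eqb a j)) (lookup∘tabulate _ i)) ⟩
    sumFin s (λ r → 𝟙 (eqb (clamp m (rowLength i r)) j))
      ≡⟨ sumFin-rows (λ a → 𝟙 (eqb (clamp m a) j)) (α i) (α∈C i) ⟩
    sumFin (suc m) (λ j' → lookup (α i) j' * 𝟙 (eqb (clamp m (toℕ j')) j))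
      ≡⟨ sumFin-cong (suc m) (λ j' → trans (cong (λ a → lookup (α i) j' * 𝟙 (eqb a j)) (clamp-toℕ m j'))
                                            (trans (*-comm (lookup (α i) j') _) (cong (λ b → 𝟙 b * lookup (α i) j') (eqb-sym j' j)))) ⟩
    sumFin (suc m) (λ j' → 𝟙 (eqb j j') * lookup (α i) j')
      ≡⟨ sumFin-𝟙-eqb (suc m) j (lookup (α i)) ⟩
    lookup (α i) j ∎
    where open ≡-Reasoning

  cellCount : Fin s → ℕ → ℕ
  cellCount r c = count d (λ i → c <ᵇ rowLength i r)

  above-rowPoint : ∀ r (c : Fin m) → above (rowPoint r) (toℕ c) ≡ cellCount r (toℕ c)
  above-rowPoint r c = sumFin-cong d (λ i → cong 𝟙 (begin
    toℕ c <ᵇ toℕ (lookup (rowPoint r) i)     ≡⟨ cong (λ a → toℕ c <ᵇ toℕ a) (lookup∘tabulate _ i) ⟩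
    toℕ c <ᵇ toℕ (clamp m (rowLength i r))   ≡⟨ cong (toℕ c <ᵇ_) (toℕ-clamp m (rowLength i r)) ⟩
    toℕ c <ᵇ rowLength i r ⊓ m               ≡⟨ <ᵇ-⊓ (toℕ c) (rowLength i r) m (toℕ<n c) ⟩
    toℕ c <ᵇ rowLength i r                   ∎))
    where open ≡-Reasoning

  ▲ : ℕ
  ▲ = triangle s m d (λ i → Young s (suc m) (α i))

  cost-rowPlan : cost rowPlan ≡ ▲
  cost-rowPlan = begin
    cost rowPlan                                                          ≡⟨ sumPts-*-rowPlan diagDist ⟩
    sumFin s (λ r → diagDist (rowPoint r))                                ≡⟨ sumFin-cong s (λ r → diagDist≡sumFin-minority (rowPoint r)) ⟩
    sumFin s (λ r → sumFin m (λ c → minority d (above (rowPoint r) (toℕ c))))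
      ≡⟨ sumFin-cong s (λ r → sumFin-cong m (λ c → cong (minority d) (above-rowPoint r c))) ⟩
    ▲                                                                     ∎
    where open ≡-Reasoning

  row-length-bound : ∀ i (r : Fin s) → toℕ r < length (word (α i))
  row-length-bound i r = subst (toℕ r <_) (sym (trans (length-wordFrom 0 (α i)) (α∈C i))) (toℕ<n r)

  -- Column c of Y(α i) consists of the rows r ≥ atMost c 0 (α i); compare each diagram with the rows r ≥ M.
  column-rows≤ : ∀ c M → sumFin s (λ r → minority d (cellCount r c)) ≤ sumFin d (λ i → ∣ atMost c 0 (α i) - M ∣)
  column-rows≤ c M = begin
    sumFin s (λ r → minority d (cellCount r c))
      ≤⟨ sumFin-mono-≤ s (λ r → minority≤ d (cellCount r c) (M ≤ᵇ toℕ r)) ⟩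
    sumFin s (λ r → if M ≤ᵇ toℕ r then d ∸ cellCount r c else cellCount r c)
      ≡⟨ sumFin-cong s (λ r → sumFin-∣𝟙-𝟙∣≡count d (λ i → c <ᵇ rowLength i r) (M ≤ᵇ toℕ r)) ⟨
    sumFin s (λ r → sumFin d (λ i → ∣ 𝟙 (c <ᵇ rowLength i r) - 𝟙 (M ≤ᵇ toℕ r) ∣))
      ≡⟨ sumFin-comm s d _ ⟩
    sumFin d (λ i → sumFin s (λ r → ∣ 𝟙 (c <ᵇ rowLength i r) - 𝟙 (M ≤ᵇ toℕ r) ∣))
      ≡⟨ sumFin-cong d (λ i → sumFin-cong s (λ r →
           cong (λ b → ∣ 𝟙 b - 𝟙 (M ≤ᵇ toℕ r) ∣) (<ᵇ-entry-wordFrom c 0 (α i) (toℕ r) (row-length-bound i r)))) ⟩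
    sumFin d (λ i → sumFin s (λ r → ∣ 𝟙 (atMost c 0 (α i) ≤ᵇ toℕ r) - 𝟙 (M ≤ᵇ toℕ r) ∣))
      ≤⟨ sumFin-mono-≤ d (λ i → sumFin-∣𝟙≤ᵇ-𝟙≤ᵇ∣≤∣-∣ s (atMost c 0 (α i)) M) ⟩
    sumFin d (λ i → ∣ atMost c 0 (α i) - M ∣) ∎
    where open ≤-Reasoning

  module _ (J : Vec (Fin (suc m)) d → ℕ) (feasible : Feasible α J) where

    majority : Vec (Fin (suc m)) d → ℕ → Bool
    majority x c = d <ᵇ above x c + above x c

    minorityMass : ℕ → ℕ
    minorityMass c = sumPts (suc m) d (λ x → 𝟙 (not (majority x c)) * J x)

    atMost≡marginal : ∀ c i → atMost c 0 (α i) ≡ sumPts (suc m) d (λ x → 𝟙 (not (c <ᵇ toℕ (lookup x i))) * J x)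
    atMost≡marginal c i = sym (feasible-marginal {α = α} feasible i (λ j → 𝟙 (not (c <ᵇ toℕ j))))

    minority*J : ∀ x c → minority d (above x c) * J x ≡
      sumFin d (λ i → ∣ 𝟙 (not (c <ᵇ toℕ (lookup x i))) * J x - 𝟙 (not (majority x c)) * J x ∣)
    minority*J x c = begin
      minority d (above x c) * J x
        ≡⟨ cong (_* J x) (minority≡ d (above x c) (count≤ d _)) ⟩
      (if majority x c then d ∸ above x c else above x c) * J x
        ≡⟨ cong (_* J x) (sumFin-∣𝟙-𝟙∣≡count d (λ i → c <ᵇ toℕ (lookup x i)) (majority x c)) ⟨
      sumFin d (λ i → ∣ 𝟙 (c <ᵇ toℕ (lookup x i)) - 𝟙 (majority x c) ∣) * J x
        ≡⟨ sumFin-distribʳ-* d _ (J x) ⟨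
      sumFin d (λ i → ∣ 𝟙 (c <ᵇ toℕ (lookup x i)) - 𝟙 (majority x c) ∣ * J x)
        ≡⟨ sumFin-cong d (λ i → trans (cong (_* J x) (∣𝟙-𝟙∣≡∣𝟙-not-𝟙-not∣ (c <ᵇ toℕ (lookup x i)) (majority x c)))
                                      (*-distribʳ-∣-∣ (J x) (𝟙 (not (c <ᵇ toℕ (lookup x i)))) (𝟙 (not (majority x c))))) ⟩
      sumFin d (λ i → ∣ 𝟙 (not (c <ᵇ toℕ (lookup x i))) * J x - 𝟙 (not (majority x c)) * J x ∣) ∎
      where open ≡-Reasoning

    column-plan≥ : ∀ c → sumFin d (λ i → ∣ atMost c 0 (α i) - minorityMass c ∣) ≤
                         sumPts (suc m) d (λ x → minority d (above x c) * J x)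
    column-plan≥ c = begin
      sumFin d (λ i → ∣ atMost c 0 (α i) - minorityMass c ∣)
        ≤⟨ sumFin-mono-≤ d (λ i → ≤-trans (≤-reflexive (cong ∣_- minorityMass c ∣ (atMost≡marginal c i)))
                                           (∣sumPts-sumPts∣≤sumPts∣-∣ (suc m) d _ _)) ⟩
      sumFin d (λ i → sumPts (suc m) d (λ x → ∣ 𝟙 (not (c <ᵇ toℕ (lookup x i))) * J x - 𝟙 (not (majority x c)) * J x ∣))
        ≡⟨ sumPts-sumFin-comm (suc m) d d _ ⟨
      sumPts (suc m) d (λ x → sumFin d (λ i → ∣ 𝟙 (not (c <ᵇ toℕ (lookup x i))) * J x - 𝟙 (not (majority x c)) * J x ∣))
        ≡⟨ sumPts-cong (suc m) d (λ x → minority*J x c) ⟨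
      sumPts (suc m) d (λ x → minority d (above x c) * J x) ∎
      where open ≤-Reasoning

    ▲≤cost : ▲ ≤ cost J
    ▲≤cost = begin
      ▲                                                                         ≡⟨ sumFin-comm s m _ ⟩
      sumFin m (λ c → sumFin s (λ r → minority d (cellCount r (toℕ c))))
        ≤⟨ sumFin-mono-≤ m (λ c → ≤-trans (column-rows≤ (toℕ c) (minorityMass (toℕ c))) (column-plan≥ (toℕ c))) ⟩
      sumFin m (λ c → sumPts (suc m) d (λ x → minority d (above x (toℕ c)) * J x))
        ≡⟨ sumPts-sumFin-comm (suc m) d m _ ⟨
      sumPts (suc m) d (λ x → sumFin m (λ c → minority d (above x (toℕ c)) * J x))
        ≡⟨ sumPts-cong (suc m) d (λ x → trans (sumFin-distribʳ-* m _ (J x)) (cong (_* J x) (sym (diagDist≡sumFin-minority x)))) ⟩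
      cost J                                                                    ∎
      where open ≤-Reasoning

theorem1 : (s n d : ℕ) → 1 ≤ s → 1 ≤ n → 2 ≤ d →
    (α : Fin d → Vec ℕ n) → (∀ i → IsComposition s n (α i)) →
    IsEMC α (triangle s (n ∸ 1) d (λ i → Young s n (α i)))
theorem1 s zero    d _ () _ _ _
theorem1 s (suc m) d _ _  _ α α∈C =
  (rowPlan s m d α α∈C , rowPlan-feasible s m d α α∈C , cost-rowPlan s m d α α∈C) ,
  ▲≤cost s m d α α∈C
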